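{- Let $\delta^*$ be a minimal feasible integral solution of the covering formulation [COV]. For any $i,j,k,\ell\in V$ with $j\neq k$ and $i\neq \ell$, if $\delta^*_{(j,k)}=1$, $\delta^*_{(k,j)}=0$, $(i,j)\in P$ and $(k,\ell)\in P$, then $\delta^*_{(i,\ell)}=1$ and $\delta^*_{(\ell,i)}=0$.
   Context: $V$ is a finite set and $P$ a partial order on $V$ (reflexive, antisymmetric, transitive, viewed as a set of ordered pairs, so $(x,x)\in P$ for all $x$). $\mathrm{inc}(P)=\{(x,y)\in V\times V:(x,y)\notin P,\ (y,x)\notin P\}$. A solution is a vector $\delta=(\delta_{(i,j)})$ indexed by ordered pairs of distinct elements of $V$, where only entries on pairs of $\mathrm{inc}(P)$ are free; by convention, for $i\neq j$, $\delta_{(i,j)}=1$ if $(i,j)\in P$ and $\delta_{(i,j)}=0$ if $(j,i)\in P$. Covering formulation [COV]: $\delta_{(i,j)}\in\{0,1\}$ for $(i,j)\in\mathrm{inc}(P)$, subject to (C2) $\delta_{(x_1,y_1)}+\delta_{(x_2,y_2)}\ge1$ for all $x_1,y_1,x_2,y_2\in V$ with $x_1\ne y_1$, $x_2\ne y_2$, $(x_2,y_1),(x_1,y_2)\in P$; and (C3) $\delta_{(x_1,y_1)}+\delta_{(x_2,y_2)}+\delta_{(x_3,y_3)}\ge1$ for all $x_1,\dots,y_3\in V$ with $x_i\ne y_i$, $(x_2,y_1),(x_3,y_2),(x_1,y_3)\in P$. A feasible $0/1$ solution $\delta^*$ of [COV] is minimal if for every $(i,j)\in\mathrm{inc}(P)$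 with $\delta^*_{(i,j)}=1$, changing $\delta^*_{(i,j)}$ to $0$ yields a solution that is not feasible for [COV]. -}

module Defs where

open import Data.Nat using (ℕ)
open import Data.Fin using (Fin; _≟_)
open import Data.Bool using (Bool; true; false; if_then_else_; _∧_)
open import Data.Product using (_×_)
open import Data.Sum using (_⊎_)
open import Relation.Binary.PropositionalEquality using (_≡_)
open import Relation.Binary using (Rel; IsPartialOrder)
open import Relation.Nullary using (¬_)
open import Relation.Nullary.Decidable using (⌊_⌋)

-- Ground set V = Fin n.
-- A 0/1 vector δ indexed by ordered pairs is a function Fin n → Fin n → Bool
-- (δ i j = true  means δ_(i,j) = 1); diagonal entries are irrelevant.

inc : ∀ {n} → Rel (Fin n) _ → Fin n → Fin n → Set
inc P x y = ¬ P x y × ¬ P y x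

Conventional : ∀ {n} → Rel (Fin n) _ → (Fin n → Fin n → Bool) → Set
Conventional P δ = ∀ i j → ¬ i ≡ j →
  (P i j → δ i j ≡ true) × (P j i → δ i j ≡ false)

C2 : ∀ {n} → Rel (Fin n) _ → (Fin n → Fin n → Bool) → Set
C2 P δ = ∀ x₁ y₁ x₂ y₂ → ¬ x₁ ≡ y₁ → ¬ x₂ ≡ y₂ → P x₂ y₁ → P x₁ y₂ →
  δ x₁ y₁ ≡ true ⊎ δ x₂ y₂ ≡ true

C3 : ∀ {n} → Rel (Fin n) _ → (Fin n → Fin n → Bool) → Set
C3 P δ = ∀ x₁ y₁ x₂ y₂ x₃ y₃ → ¬ x₁ ≡ y₁ → ¬ x₂ ≡ y₂ → ¬ x₃ ≡ y₃ →
  P x₂ y₁ → P x₃ y₂ → P x₁ y₃ →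
  δ x₁ y₁ ≡ true ⊎ (δ x₂ y₂ ≡ true ⊎ δ x₃ y₃ ≡ true)

Feasible : ∀ {n} → Rel (Fin n) _ → (Fin n → Fin n → Bool) → Set
Feasible P δ = Conventional P δ × C2 P δ × C3 P δ

setZero : ∀ {n} → (Fin n → Fin n → Bool) → Fin n → Fin n → (Fin n → Fin n → Bool)
setZero δ i j a b = if ⌊ a ≟ i ⌋ ∧ ⌊ b ≟ j ⌋ then false else δ a b

Minimal : ∀ {n} → Rel (Fin n) _ → (Fin n → Fin n → Bool) → Set
Minimal P δ = Feasible P δ ×
  (∀ i j → inc P i j → δ i j ≡ true → ¬ Feasible P (setZero δ i j))

-- Since δ(k,j) = 0, constraint (C2) for the pairs (i,ℓ) and (k,j) forces δ(i,ℓ) = 1.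
-- For δ(ℓ,i) = 0 only the incomparable case is interesting: there every (C2) or (C3)
-- constraint containing (ℓ,i) remains satisfied after setting δ(ℓ,i) to 0, because
-- substituting (k,j) for (ℓ,i) (legitimate as k ≤ ℓ and i ≤ j) yields a constraint of
-- the same kind in which (k,j) contributes 0, so one of the other pairs is already 1.
-- Hence δ(ℓ,i) = 1 would contradict minimality.
module Submission where

open import Defs
open import Data.Nat using (ℕ)
open import Data.Fin using (Fin; _≟_)
open import Data.Bool using (Bool; true; false)
open import Data.Product using (_×_; _,_; proj₁; proj₂)
open import Data.Sum using (_⊎_; inj₁; inj₂)
open import Data.Empty using (⊥-elim)
open import Relation.Binary using (Rel; IsPartialOrder; Decidable; Transitive)
open import Relation.Binary.PropositionalEquality using (_≡_; _≢_; refl; sym; trans)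
open import Relation.Nullary using (¬_; yes; no; contradiction)
open import Function using (_∘_)
open import Level using (0ℓ)

≡false⇒≢true : ∀ {b} → b ≡ false → b ≢ true
≡false⇒≢true refl ()

module _ {n : ℕ} (δ : Fin n → Fin n → Bool) (l i : Fin n) where

  setZero-other : ∀ {a b} → ¬ (a ≡ l × b ≡ i) → setZero δ l i a b ≡ δ a b
  setZero-other {a} {b} ¬hit with a ≟ l | b ≟ i
  ... | yes a≡l | yes b≡i = contradiction (a≡l , b≡i) ¬hit
  ... | yes _   | no _    = refl
  ... | no _    | yes _   = refl
  ... | no _    | no _    = refl

  setZero-false : ∀ {a b} → δ a b ≡ false → setZero δ l i a b ≡ false
  setZero-false {a} {b} δab≡false with a ≟ l | b ≟ i
  ... | yes _ | yes _ = refl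
  ... | yes _ | no _  = δab≡false
  ... | no _  | yes _ = δab≡false
  ... | no _  | no _  = δab≡false

  setZero-true : ∀ {a b} → δ a b ≡ true → (a ≡ l × b ≡ i) ⊎ setZero δ l i a b ≡ true
  setZero-true {a} {b} δab≡true with a ≟ l | b ≟ i
  ... | yes a≡l | yes b≡i = inj₁ (a≡l , b≡i)
  ... | yes _   | no _    = inj₂ δab≡true
  ... | no _    | yes _   = inj₂ δab≡true
  ... | no _    | no _    = inj₂ δab≡true

module SetZeroFeasible
  {n : ℕ} {P : Rel (Fin n) 0ℓ} (P-trans : Transitive P)
  {δ : Fin n → Fin n → Bool} (feasible : Feasible P δ)
  {l i k j : Fin n} (¬Pli : ¬ P l i) (k≢j : k ≢ j) (δkj≡false : δ k j ≡ false)
  (Pkl : P k l) (Pij : P i j) where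

  private
    δ′ : Fin n → Fin n → Bool
    δ′ = setZero δ l i

    conventional : Conventional P δ
    conventional = proj₁ feasible

    c2 : C2 P δ
    c2 = proj₁ (proj₂ feasible)

    c3 : C3 P δ
    c3 = proj₂ (proj₂ feasible)

    δkj≢true : δ k j ≢ true
    δkj≢true = ≡false⇒≢true δkj≡false

    ¬hitˡ : ∀ {a b} → P a i → ¬ (a ≡ l × b ≡ i)
    ¬hitˡ Pai (refl , _) = ¬Pli Pai

    ¬hitʳ : ∀ {a b} → P l b → ¬ (a ≡ l × b ≡ i)
    ¬hitʳ Plb (_ , refl) = ¬Pli Plb

    keep-true : ∀ {a b} → ¬ (a ≡ l × b ≡ i) → δ a b ≡ true → δ′ a b ≡ true
    keep-true ¬hit δab≡true = trans (setZero-other δ l i ¬hit) δab≡true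

    C2-partner : ∀ a b → a ≢ b → P a i → P l b → δ′ a b ≡ true
    C2-partner a b a≢b Pai Plb
      with c2 a b k j a≢b k≢j (P-trans Pkl Plb) (P-trans Pai Pij)
    ... | inj₁ δab≡true = keep-true (¬hitˡ Pai) δab≡true
    ... | inj₂ δkj≡true = contradiction δkj≡true δkj≢true

    C3-partners : ∀ x₂ y₂ x₃ y₃ → x₂ ≢ y₂ → x₃ ≢ y₃ →
      P x₂ i → P x₃ y₂ → P l y₃ → δ′ x₂ y₂ ≡ true ⊎ δ′ x₃ y₃ ≡ true
    C3-partners x₂ y₂ x₃ y₃ x₂≢y₂ x₃≢y₃ Px₂i Px₃y₂ Ply₃
      with c3 k j x₂ y₂ x₃ y₃ k≢j x₂≢y₂ x₃≢y₃
              (P-trans Px₂i Pij) Px₃y₂ (P-trans Pkl Ply₃)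
    ... | inj₁ δkj≡true        = contradiction δkj≡true δkj≢true
    ... | inj₂ (inj₁ δ₂≡true) = inj₁ (keep-true (¬hitˡ Px₂i) δ₂≡true)
    ... | inj₂ (inj₂ δ₃≡true) = inj₂ (keep-true (¬hitʳ Ply₃) δ₃≡true)

    conventional′ : Conventional P δ′
    conventional′ a b a≢b = fixed-true , fixed-false
      where
      fixed-true : P a b → δ′ a b ≡ true
      fixed-true Pab with setZero-true δ l i (conventional a b a≢b .proj₁ Pab)
      ... | inj₁ (refl , refl) = contradiction Pab ¬Pli
      ... | inj₂ δ′ab≡true     = δ′ab≡true

      fixed-false : P b a → δ′ a b ≡ false
      fixed-false Pba = setZero-false δ l i (conventional a b a≢b .proj₂ Pba)

    c2′ : C2 P δ′
    c2′ x₁ y₁ x₂ y₂ x₁≢y₁ x₂≢y₂ Px₂y₁ Px₁y₂ with c2 x₁ y₁ x₂ y₂ x₁≢y₁ x₂≢y₂ Px₂y₁ Px₁y₂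
    ... | inj₁ δ₁≡true with setZero-true δ l i δ₁≡true
    ...   | inj₁ (refl , refl) = inj₂ (C2-partner x₂ y₂ x₂≢y₂ Px₂y₁ Px₁y₂)
    ...   | inj₂ δ′₁≡true      = inj₁ δ′₁≡true
    c2′ x₁ y₁ x₂ y₂ x₁≢y₁ x₂≢y₂ Px₂y₁ Px₁y₂ | inj₂ δ₂≡true with setZero-true δ l i δ₂≡true
    ...   | inj₁ (refl , refl) = inj₁ (C2-partner x₁ y₁ x₁≢y₁ Px₁y₂ Px₂y₁)
    ...   | inj₂ δ′₂≡true      = inj₂ δ′₂≡true

    c3′ : C3 P δ′
    c3′ x₁ y₁ x₂ y₂ x₃ y₃ x₁≢y₁ x₂≢y₂ x₃≢y₃ Px₂y₁ Px₃y₂ Px₁y₃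
      with c3 x₁ y₁ x₂ y₂ x₃ y₃ x₁≢y₁ x₂≢y₂ x₃≢y₃ Px₂y₁ Px₃y₂ Px₁y₃
    ... | inj₁ δ₁≡true with setZero-true δ l i δ₁≡true
    ...   | inj₁ (refl , refl) = inj₂ (C3-partners x₂ y₂ x₃ y₃ x₂≢y₂ x₃≢y₃ Px₂y₁ Px₃y₂ Px₁y₃)
    ...   | inj₂ δ′₁≡true      = inj₁ δ′₁≡true
    c3′ x₁ y₁ x₂ y₂ x₃ y₃ x₁≢y₁ x₂≢y₂ x₃≢y₃ Px₂y₁ Px₃y₂ Px₁y₃ | inj₂ (inj₁ δ₂≡true)
      with setZero-true δ l i δ₂≡true
    ...   | inj₂ δ′₂≡true      = inj₂ (inj₁ δ′₂≡true)
    ...   | inj₁ (refl , refl)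
      with C3-partners x₃ y₃ x₁ y₁ x₃≢y₃ x₁≢y₁ Px₃y₂ Px₁y₃ Px₂y₁
    ...     | inj₁ δ′₃≡true = inj₂ (inj₂ δ′₃≡true)
    ...     | inj₂ δ′₁≡true = inj₁ δ′₁≡true
    c3′ x₁ y₁ x₂ y₂ x₃ y₃ x₁≢y₁ x₂≢y₂ x₃≢y₃ Px₂y₁ Px₃y₂ Px₁y₃ | inj₂ (inj₂ δ₃≡true)
      with setZero-true δ l i δ₃≡true
    ...   | inj₂ δ′₃≡true      = inj₂ (inj₂ δ′₃≡true)
    ...   | inj₁ (refl , refl)
      with C3-partners x₁ y₁ x₂ y₂ x₁≢y₁ x₂≢y₂ Px₁y₃ Px₂y₁ Px₃y₂
    ...     | inj₁ δ′₁≡true = inj₁ δ′₁≡true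
    ...     | inj₂ δ′₂≡true = inj₂ (inj₁ δ′₂≡true)

  setZero-feasible : Feasible P (setZero δ l i)
  setZero-feasible = conventional′ , c2′ , c3′

lemma1 : (n : ℕ) (P : Rel (Fin n) 0ℓ) → IsPartialOrder _≡_ P → Decidable P →
    (δ : Fin n → Fin n → Bool) → Minimal P δ →
    ∀ i j k ℓ → ¬ j ≡ k → ¬ i ≡ ℓ →
    δ j k ≡ true → δ k j ≡ false → P i j → P k ℓ →
    δ i ℓ ≡ true × δ ℓ i ≡ false
lemma1 n P po P? δ (feasible@(conventional , c2 , _) , minimal)
       i j k l j≢k i≢l _ δkj≡false Pij Pkl = δil≡true , δli≡false
  where
  P-trans : Transitive P
  P-trans = IsPartialOrder.trans po

  k≢j : k ≢ j
  k≢j = j≢k ∘ sym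

  δkj≢true : δ k j ≢ true
  δkj≢true = ≡false⇒≢true δkj≡false

  δil≡true : δ i l ≡ true
  δil≡true with c2 i l k j i≢l k≢j Pkl Pij
  ... | inj₁ δil≡true = δil≡true
  ... | inj₂ δkj≡true = contradiction δkj≡true δkj≢true

  δli≡false : δ l i ≡ false
  δli≡false with P? l i | P? i l
  ... | yes Pli | _ =
    contradiction (proj₁ (conventional k j k≢j) (P-trans Pkl (P-trans Pli Pij))) δkj≢true
  ... | no _ | yes Pil = proj₂ (conventional l i (i≢l ∘ sym)) Pil
  ... | no ¬Pli | no ¬Pil with δ l i in δli
  ...   | false = refl
  ...   | true  = ⊥-elim (minimal l i (¬Pli , ¬Pil) δli
                    (SetZeroFeasible.setZero-feasible P-trans feasible ¬Pli k≢j δkj≡false Pkl Pij))
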